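{- Let $\Delta(q) = q\prod_{n\geq1}(1-q^n)^{24}$ and $C(q) = q\prod_{n \geq 1}(1-q^{3n})^8$ (i.e. $C(q)=\eta(3\tau)^8$, the unique normalized cusp form of weight $4$ and level $\Gamma_0(9)$). Then, coefficientwise, \[ C(q) \equiv \Delta(q) + \Delta(q^9) \pmod 2. \] -}

module Defs where

open import Data.Nat as ℕ using (ℕ; zero; suc; _∸_; _≡ᵇ_; _%_; _/_)
open import Data.Bool using (if_then_else_)
open import Data.List using (List; map; foldr; upTo)
open import Data.Integer as ℤ using (ℤ; +_; -_; _+_; _*_; _-_)

Series : Set
Series = ℕ → ℤ

sumℤ : List ℤ → ℤ
sumℤ = foldr _+_ (+ 0)

_⊛_ : Series → Series → Series
(f ⊛ g) m = sumℤ (map (λ i → f i * g (m ∸ i)) (upTo (suc m)))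

one : Series
one zero    = + 1
one (suc _) = + 0

-- the series 1 - q^k   (used only with k ≥ 1)
oneMinusQ^ : ℕ → Series
oneMinusQ^ k j = if j ≡ᵇ 0 then + 1 else (if j ≡ᵇ k then - (+ 1) else + 0)

_^ˢ_ : Series → ℕ → Series
f ^ˢ zero  = one
f ^ˢ suc e = f ⊛ (f ^ˢ e)

prodUpTo : (a e N : ℕ) → Series
prodUpTo a e zero    = one
prodUpTo a e (suc N) = prodUpTo a e N ⊛ (oneMinusQ^ (a ℕ.* suc N) ^ˢ e)

-- The infinite product ∏_{n≥1} (1 - q^{a n})^e  (a ≥ 1): its coefficient of q^m
-- only depends on the factors with a n ≤ m, hence on those with n ≤ m.
infProd : (a e : ℕ) → Series
infProd a e m = prodUpTo a e m m

Δ : Series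
Δ zero    = + 0
Δ (suc m) = infProd 1 24 m

C : Series
C zero    = + 0
C (suc m) = infProd 3 8 m

Δ[q^9] : Series
Δ[q^9] m = if (m % 9) ≡ᵇ 0 then Δ (m / 9) else + 0

-- Mod 2, (1 + x)² ≡ 1 + x², so C/q ≡ ∏ (1 + q^{24n}) and Δ/q ≡ ∏ (1 + q^{8n}) (1 + q^{16n}).
-- By Euler's pentagonal number theorem the first is Σ_k q^{24 k(3k−1)/2}; by Jacobi's identity
-- ∏ (1 − q^n)³ = Σ_j (−1)^j (2j+1) q^{T(j)}, T(j) = j(j+1)/2, the second is Σ_j q^{8T(j)}.
-- Splitting j by its residue mod 3, 8T(3i+2) and 8T(3i+3) are 24 times the pentagonal numbers
-- k(3k∓1)/2 with k = i+1, while 8T(3i+1) = 8 + 9·8T(i) are the exponents of Δ(q^9)/q.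
-- Both identities are proved mod 2 for finite products, which agree with the infinite ones up to
-- the degree at hand: Euler's from Shanks' finite form of it, and Jacobi's by multiplying it with
-- ∏ (1 + q^{2n−1}), which turns it into Gauss' identity ∏ (1 − q^{2n})/(1 − q^{2n−1}) = Σ_j q^{T(j)},
-- again proved in a finite form of Shanks' type.

module Submission where

open import Defs

module Mod2 where

  open import Data.Nat
    using (ℕ; zero; suc; _+_; _*_; _∸_; _≤_; _<_; z≤n; s≤s; _≡ᵇ_; NonZero; >-nonZero⁻¹; parity)
  open import Data.Nat.Properties
  open import Data.Nat.Divisibility using (_∣_; divides)
  open import Data.Nat.DivMod using (_%_; _/_; m≡m%n+[m/n]*n; m*n%n≡0)
  open import Data.Nat.Tactic.RingSolver using (solve-∀)
  open import Data.Integer as ℤ using (ℤ; -[1+_]; ∣_∣; _⊖_)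
  import Data.Integer.Properties as ℤₚ
  open import Data.Parity.Base using (Parity; 0ℙ; 1ℙ) renaming (_+_ to _+₂_; _*_ to _*₂_)
  import Data.Parity.Properties as ℙ
  open import Algebra.Properties.CommutativeSemigroup ℙ.+-commutativeSemigroup
    using (interchange; xy∙z≈zx∙y; xy∙z≈xz∙y)
  open import Data.Bool using (true; false; if_then_else_; T)
  open import Data.Bool.Properties using (if-float)
  open import Data.List using (foldr; map; applyUpTo; upTo)
  open import Data.List.Properties using (map-applyUpTo)
  open import Data.Sum using (inj₁; inj₂)
  open import Data.Unit using (tt)
  open import Function using (_∘_; id)
  open import Relation.Nullary using (yes; no; contradiction)
  open import Relation.Binary.PropositionalEquality

  parityℤ : ℤ → Parity
  parityℤ i = parity ∣ i ∣

  parity-suc+suc : ∀ m n → parity (suc m) +₂ parity (suc n) ≡ parity m +₂ parity n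
  parity-suc+suc m n = begin
    parity (suc m) +₂ parity (suc n)  ≡⟨ ℙ.+-homo-+ (suc m) (suc n) ⟨
    parity (suc m + suc n)            ≡⟨ cong (parity ∘ suc) (+-suc m n) ⟩
    parity (m + n)                    ≡⟨ ℙ.+-homo-+ m n ⟩
    parity m +₂ parity n              ∎
    where open ≡-Reasoning

  parity-∣⊖∣ : ∀ m n → parity ∣ m ⊖ n ∣ ≡ parity m +₂ parity n
  parity-∣⊖∣ m       zero    = sym (ℙ.+-identityʳ (parity m))
  parity-∣⊖∣ zero    (suc n) = refl
  parity-∣⊖∣ (suc m) (suc n) = begin
    parity ∣ suc m ⊖ suc n ∣          ≡⟨ cong (parity ∘ ∣_∣) (ℤₚ.[1+m]⊖[1+n]≡m⊖n m n) ⟩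
    parity ∣ m ⊖ n ∣                  ≡⟨ parity-∣⊖∣ m n ⟩
    parity m +₂ parity n              ≡⟨ parity-suc+suc m n ⟨
    parity (suc m) +₂ parity (suc n)  ∎
    where open ≡-Reasoning

  parityℤ-homo-+ : ∀ i j → parityℤ (i ℤ.+ j) ≡ parityℤ i +₂ parityℤ j
  parityℤ-homo-+ (ℤ.+ m)  (ℤ.+ n)  = ℙ.+-homo-+ m n
  parityℤ-homo-+ (ℤ.+ m)  -[1+ n ] = parity-∣⊖∣ m (suc n)
  parityℤ-homo-+ -[1+ m ] (ℤ.+ n)  = trans (parity-∣⊖∣ n (suc m)) (ℙ.+-comm (parity n) _)
  parityℤ-homo-+ -[1+ m ] -[1+ n ] = trans (ℙ.+-homo-+ m n) (sym (parity-suc+suc m n))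

  parityℤ-homo-* : ∀ i j → parityℤ (i ℤ.* j) ≡ parityℤ i *₂ parityℤ j
  parityℤ-homo-* i j = trans (cong parity (ℤₚ.∣i*j∣≡∣i∣*∣j∣ i j)) (ℙ.*-homo-* ∣ i ∣ ∣ j ∣)

  parityℤ-homo-- : ∀ i → parityℤ (ℤ.- i) ≡ parityℤ i
  parityℤ-homo-- i = cong parity (ℤₚ.∣-i∣≡∣i∣ i)

  parity≡0ℙ⇒2∣ : ∀ n → parity n ≡ 0ℙ → 2 ∣ n
  parity≡0ℙ⇒2∣ zero          _ = divides 0 refl
  parity≡0ℙ⇒2∣ (suc (suc n)) p with parity≡0ℙ⇒2∣ n p
  ... | divides k n≡k*2 = divides (suc k) (cong (suc ∘ suc) n≡k*2)

  +₂-move : ∀ a b c → a +₂ b ≡ c → a ≡ b +₂ c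
  +₂-move a b c a+b≡c = begin
    a               ≡⟨ ℙ.+-identityʳ a ⟨
    a +₂ 0ℙ         ≡⟨ cong (a +₂_) (ℙ.p+p≡0ℙ b) ⟨
    a +₂ (b +₂ b)   ≡⟨ ℙ.+-assoc a b b ⟨
    a +₂ b +₂ b     ≡⟨ cong (_+₂ b) a+b≡c ⟩
    c +₂ b          ≡⟨ ℙ.+-comm c b ⟩
    b +₂ c          ∎
    where open ≡-Reasoning

  +₂-cancel-middle : ∀ a b c → (a +₂ b) +₂ (b +₂ c) ≡ a +₂ c
  +₂-cancel-middle a b c = begin
    (a +₂ b) +₂ (b +₂ c) ≡⟨ ℙ.+-assoc a b (b +₂ c) ⟩
    a +₂ (b +₂ (b +₂ c)) ≡⟨ cong (a +₂_) (sym (ℙ.+-assoc b b c)) ⟩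
    a +₂ ((b +₂ b) +₂ c) ≡⟨ cong (λ x → a +₂ (x +₂ c)) (ℙ.p+p≡0ℙ b) ⟩
    a +₂ c               ∎
    where open ≡-Reasoning

  -- ∑< and [1+q^_]·_ are opaque so that unification compares them by their arguments
  -- instead of unfolding them.
  opaque
    ∑< : ℕ → (ℕ → Parity) → Parity
    ∑< n h = foldr _+₂_ 0ℙ (applyUpTo h n)

    ∑<-cong : ∀ n {h g : ℕ → Parity} → (∀ {i} → i < n → h i ≡ g i) → ∑< n h ≡ ∑< n g
    ∑<-cong zero    h≡g = refl
    ∑<-cong (suc n) h≡g = cong₂ _+₂_ (h≡g (s≤s z≤n)) (∑<-cong n (λ i<n → h≡g (s≤s i<n)))

    ∑<-zero : ∀ n {h : ℕ → Parity} → (∀ {i} → i < n → h i ≡ 0ℙ) → ∑< n h ≡ 0ℙ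
    ∑<-zero zero    h≡0 = refl
    ∑<-zero (suc n) h≡0 = cong₂ _+₂_ (h≡0 (s≤s z≤n)) (∑<-zero n (λ i<n → h≡0 (s≤s i<n)))

    ∑<-+ : ∀ n (h g : ℕ → Parity) → ∑< n (λ i → h i +₂ g i) ≡ ∑< n h +₂ ∑< n g
    ∑<-+ zero    h g = refl
    ∑<-+ (suc n) h g = trans (cong (h 0 +₂ g 0 +₂_) (∑<-+ n (h ∘ suc) (g ∘ suc)))
                             (interchange (h 0) (g 0) (∑< n (h ∘ suc)) (∑< n (g ∘ suc)))

    ∑<-suc : ∀ n (h : ℕ → Parity) → ∑< (suc n) h ≡ ∑< n h +₂ h n
    ∑<-suc zero    h = ℙ.+-identityʳ (h 0)
    ∑<-suc (suc n) h = trans (cong (h 0 +₂_) (∑<-suc n (h ∘ suc))) (sym (ℙ.+-assoc (h 0) _ _))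

    ∑<-first : ∀ n (h : ℕ → Parity) → ∑< (suc n) h ≡ h 0 +₂ ∑< n (h ∘ suc)
    ∑<-first n h = refl

    ∑<-telescope : ∀ n (g : ℕ → Parity) → ∑< n (λ i → g i +₂ g (suc i)) ≡ g 0 +₂ g n
    ∑<-telescope zero    g = sym (ℙ.p+p≡0ℙ (g 0))
    ∑<-telescope (suc n) g = trans (cong (g 0 +₂ g 1 +₂_) (∑<-telescope n (g ∘ suc)))
                                   (+₂-cancel-middle (g 0) (g 1) (g (suc n)))

    parityℤ-sumℤ : ∀ n (h : ℕ → ℤ) → parityℤ (sumℤ (applyUpTo h n)) ≡ ∑< n (parityℤ ∘ h)
    parityℤ-sumℤ zero    h = refl
    parityℤ-sumℤ (suc n) h = trans (parityℤ-homo-+ (h 0) _)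
                                   (cong (parityℤ (h 0) +₂_) (parityℤ-sumℤ n (h ∘ suc)))

  Series₂ : Set
  Series₂ = ℕ → Parity

  infixl 6 _⊕_
  infixr 8 q^_·_ [1+q^_]·_
  infix  4 _≗[≤_]_

  _⊕_ : Series₂ → Series₂ → Series₂
  (f ⊕ g) m = f m +₂ g m

  0₂ 1₂ : Series₂
  0₂ _       = 0ℙ
  1₂ zero    = 1ℙ
  1₂ (suc _) = 0ℙ

  ∑ₛ : ℕ → (ℕ → Series₂) → Series₂
  ∑ₛ n F m = ∑< n (λ k → F k m)

  q^_·_ : ℕ → Series₂ → Series₂
  (q^ zero  · f) m       = f m
  (q^ suc k · f) zero    = 0ℙ
  (q^ suc k · f) (suc m) = (q^ k · f) m

  _≗[≤_]_ : Series₂ → ℕ → Series₂ → Set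
  f ≗[≤ M ] g = ∀ {m} → m ≤ M → f m ≡ g m

  ∑ₛ-telescope : ∀ n (F G H : ℕ → Series₂) → H 0 ≗ 0₂ →
                 (∀ {k} → k < n → F k ⊕ G k ≗ H k ⊕ H (suc k)) → ∑ₛ n F ≗ ∑ₛ n G ⊕ H n
  ∑ₛ-telescope n F G H H₀≗0 step m = +₂-move (∑ₛ n F m) (∑ₛ n G m) (H n m) (begin
    ∑< n (λ k → F k m) +₂ ∑< n (λ k → G k m)   ≡⟨ ∑<-+ n (λ k → F k m) (λ k → G k m) ⟨
    ∑< n (λ k → F k m +₂ G k m)                ≡⟨ ∑<-cong n (λ k<n → step k<n m) ⟩
    ∑< n (λ k → H k m +₂ H (suc k) m)          ≡⟨ ∑<-telescope n (λ k → H k m) ⟩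
    H 0 m +₂ H n m                             ≡⟨ cong (_+₂ H n m) (H₀≗0 m) ⟩
    H n m                                      ∎)
    where open ≡-Reasoning

  ∑ₛ-first : ∀ n (F : ℕ → Series₂) {m} → (∀ {k} → k < n → F (suc k) m ≡ 0ℙ) →
             ∑ₛ (suc n) F m ≡ F 0 m
  ∑ₛ-first n F {m} rest≡0 = begin
    ∑< (suc n) (λ k → F k m)              ≡⟨ ∑<-first n (λ k → F k m) ⟩
    F 0 m +₂ ∑< n (λ k → F (suc k) m)     ≡⟨ cong (F 0 m +₂_) (∑<-zero n rest≡0) ⟩
    F 0 m +₂ 0ℙ                           ≡⟨ ℙ.+-identityʳ (F 0 m) ⟩
    F 0 m                                 ∎
    where open ≡-Reasoning

  q^-cong : ∀ k {f g} → f ≗ g → q^ k · f ≗ q^ k · g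
  q^-cong zero    f≗g m       = f≗g m
  q^-cong (suc k) f≗g zero    = refl
  q^-cong (suc k) f≗g (suc m) = q^-cong k f≗g m

  q^-distrib-⊕ : ∀ k f g → q^ k · (f ⊕ g) ≗ q^ k · f ⊕ q^ k · g
  q^-distrib-⊕ zero    f g m       = refl
  q^-distrib-⊕ (suc k) f g zero    = refl
  q^-distrib-⊕ (suc k) f g (suc m) = q^-distrib-⊕ k f g m

  q^-q^ : ∀ a b f → q^ a · q^ b · f ≗ q^ (a + b) · f
  q^-q^ zero    b f m       = refl
  q^-q^ (suc a) b f zero    = refl
  q^-q^ (suc a) b f (suc m) = q^-q^ a b f m

  q^-comm : ∀ a b f → q^ a · q^ b · f ≗ q^ b · q^ a · f
  q^-comm a b f m = begin
    (q^ a · q^ b · f) m ≡⟨ q^-q^ a b f m ⟩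
    (q^ (a + b) · f) m  ≡⟨ cong (λ e → (q^ e · f) m) (+-comm a b) ⟩
    (q^ (b + a) · f) m  ≡⟨ q^-q^ b a f m ⟨
    (q^ b · q^ a · f) m ∎
    where open ≡-Reasoning

  q^-below : ∀ k f {m} → m < k → (q^ k · f) m ≡ 0ℙ
  q^-below (suc k) f {zero}  _         = refl
  q^-below (suc k) f {suc m} (s≤s m<k) = q^-below k f m<k

  q^-≗[≤] : ∀ k {M f g} → f ≗[≤ M ] g → q^ k · f ≗[≤ M ] q^ k · g
  q^-≗[≤] zero    f≗g         m≤M   = f≗g m≤M
  q^-≗[≤] (suc k) f≗g {zero}  _     = refl
  q^-≗[≤] (suc k) f≗g {suc m} 1+m≤M = q^-≗[≤] k f≗g (<⇒≤ 1+m≤M)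

  q^-∑ₛ : ∀ k n F → q^ k · ∑ₛ n F ≗ ∑ₛ n (λ j → q^ k · F j)
  q^-∑ₛ zero    n F m       = refl
  q^-∑ₛ (suc k) n F zero    = sym (∑<-zero n (λ _ → refl))
  q^-∑ₛ (suc k) n F (suc m) = q^-∑ₛ k n F m

  q^·1₂-coeff : ∀ k j → (q^ k · 1₂) j ≡ (if j ≡ᵇ k then 1ℙ else 0ℙ)
  q^·1₂-coeff zero    zero    = refl
  q^·1₂-coeff zero    (suc j) = refl
  q^·1₂-coeff (suc k) zero    = refl
  q^·1₂-coeff (suc k) (suc j) = q^·1₂-coeff k j

  q^·1₂-diag : ∀ k → (q^ k · 1₂) k ≡ 1ℙ
  q^·1₂-diag zero    = refl
  q^·1₂-diag (suc k) = q^·1₂-diag k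

  q^·1₂-off : ∀ k {j} → j ≢ k → (q^ k · 1₂) j ≡ 0ℙ
  q^·1₂-off zero    {zero}  j≢k = contradiction refl j≢k
  q^·1₂-off zero    {suc j} _   = refl
  q^·1₂-off (suc k) {zero}  _   = refl
  q^·1₂-off (suc k) {suc j} j≢k = q^·1₂-off k (j≢k ∘ cong suc)

  q^·1₂-dilate : ∀ r c x u .{{_ : NonZero c}} → (q^ r + c * x · 1₂) (r + c * u) ≡ (q^ x · 1₂) u
  q^·1₂-dilate r c x u with u ≟ x
  ... | yes refl = trans (q^·1₂-diag (r + c * u)) (sym (q^·1₂-diag u))
  ... | no  u≢x  = trans (q^·1₂-off (r + c * x) (u≢x ∘ *-cancelˡ-≡ u x c ∘ +-cancelˡ-≡ r _ _))
                         (sym (q^·1₂-off x u≢x))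

  opaque
    [1+q^_]·_ : ℕ → Series₂ → Series₂
    [1+q^ k ]· f = f ⊕ q^ k · f

    [1+q^]-coeff : ∀ k f m → ([1+q^ k ]· f) m ≡ f m +₂ (q^ k · f) m
    [1+q^]-coeff k f m = refl

    [1+q^]-cong : ∀ k {f g} → f ≗ g → [1+q^ k ]· f ≗ [1+q^ k ]· g
    [1+q^]-cong k f≗g m = cong₂ _+₂_ (f≗g m) (q^-cong k f≗g m)

    [1+q^]-distrib-⊕ : ∀ k f g → [1+q^ k ]· (f ⊕ g) ≗ [1+q^ k ]· f ⊕ [1+q^ k ]· g
    [1+q^]-distrib-⊕ k f g m = trans (cong (f m +₂ g m +₂_) (q^-distrib-⊕ k f g m))
                                     (interchange (f m) (g m) ((q^ k · f) m) ((q^ k · g) m))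

    [1+q^]-q^ : ∀ k e f → [1+q^ k ]· q^ e · f ≗ q^ e · [1+q^ k ]· f
    [1+q^]-q^ k e f m = trans (cong ((q^ e · f) m +₂_) (q^-comm k e f m))
                              (sym (q^-distrib-⊕ e f (q^ k · f) m))

    [1+q^]²-expand : ∀ a b f m → ([1+q^ a ]· [1+q^ b ]· f) m
                   ≡ (f m +₂ (q^ b · f) m) +₂ ((q^ a · f) m +₂ (q^ a · q^ b · f) m)
    [1+q^]²-expand a b f m = cong (f m +₂ (q^ b · f) m +₂_) (q^-distrib-⊕ a f (q^ b · f) m)

    [1+q^]-below : ∀ k f {m} → m < k → ([1+q^ k ]· f) m ≡ f m
    [1+q^]-below k f {m} m<k = trans (cong (f m +₂_) (q^-below k f m<k)) (ℙ.+-identityʳ (f m))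

    [1+q^]-≗[≤] : ∀ k {M f g} → f ≗[≤ M ] g → [1+q^ k ]· f ≗[≤ M ] [1+q^ k ]· g
    [1+q^]-≗[≤] k f≗g m≤M = cong₂ _+₂_ (f≗g m≤M) (q^-≗[≤] k f≗g m≤M)

    [1+q^]-cancel : ∀ k M {f g} → 0 < k → [1+q^ k ]· f ≗[≤ M ] [1+q^ k ]· g → f ≗[≤ M ] g
    [1+q^]-cancel (suc k) zero    {f} {g} _   eq z≤n = ℙ.+-cancelʳ-≡ 0ℙ (f 0) (g 0) (eq z≤n)
    [1+q^]-cancel (suc k) (suc M) {f} {g} k>0 eq = agree-up-to-suc-M
      where
      f≗g : f ≗[≤ M ] g
      f≗g = [1+q^]-cancel (suc k) M {f} {g} k>0 (λ m≤M → eq (m≤n⇒m≤1+n m≤M))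
      agree-up-to-suc-M : f ≗[≤ suc M ] g
      agree-up-to-suc-M m≤1+M with m≤n⇒m<n∨m≡n m≤1+M
      ... | inj₁ (s≤s m≤M) = f≗g m≤M
      ... | inj₂ refl      = ℙ.+-cancelʳ-≡ _ (f (suc M)) (g (suc M))
        (trans (eq ≤-refl) (cong (g (suc M) +₂_) (sym (q^-≗[≤] k f≗g ≤-refl))))

    [1+q^]-∑ₛ : ∀ k n F → [1+q^ k ]· ∑ₛ n F ≗ ∑ₛ n (λ j → [1+q^ k ]· F j)
    [1+q^]-∑ₛ k n F m = trans (cong (∑ₛ n F m +₂_) (q^-∑ₛ k n F m))
                              (sym (∑<-+ n (λ j → F j m) (λ j → (q^ k · F j) m)))

  q^·[1+q^] : ∀ e k f → q^ e · [1+q^ k ]· f ≗ q^ e · f ⊕ q^ e + k · f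
  q^·[1+q^] e k f m = begin
    (q^ e · [1+q^ k ]· f) m                ≡⟨ q^-cong e ([1+q^]-coeff k f) m ⟩
    (q^ e · (f ⊕ q^ k · f)) m              ≡⟨ q^-distrib-⊕ e f (q^ k · f) m ⟩
    (q^ e · f) m +₂ (q^ e · q^ k · f) m    ≡⟨ cong ((q^ e · f) m +₂_) (q^-q^ e k f m) ⟩
    (q^ e · f) m +₂ (q^ e + k · f) m       ∎
    where open ≡-Reasoning

  [1+q^]-comm : ∀ a b f → [1+q^ a ]· [1+q^ b ]· f ≗ [1+q^ b ]· [1+q^ a ]· f
  [1+q^]-comm a b f m = begin
    ([1+q^ a ]· [1+q^ b ]· f) m
      ≡⟨ [1+q^]²-expand a b f m ⟩
    (f m +₂ (q^ b · f) m) +₂ ((q^ a · f) m +₂ (q^ a · q^ b · f) m)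
      ≡⟨ interchange (f m) _ _ _ ⟩
    (f m +₂ (q^ a · f) m) +₂ ((q^ b · f) m +₂ (q^ a · q^ b · f) m)
      ≡⟨ cong (λ x → f m +₂ (q^ a · f) m +₂ ((q^ b · f) m +₂ x)) (q^-comm a b f m) ⟩
    (f m +₂ (q^ a · f) m) +₂ ((q^ b · f) m +₂ (q^ b · q^ a · f) m)
      ≡⟨ [1+q^]²-expand b a f m ⟨
    ([1+q^ b ]· [1+q^ a ]· f) m ∎
    where open ≡-Reasoning

  [1+q^]-frobenius : ∀ k f → [1+q^ k ]· [1+q^ k ]· f ≗ [1+q^ (2 * k) ]· f
  [1+q^]-frobenius k f m = begin
    ([1+q^ k ]· [1+q^ k ]· f) m
      ≡⟨ [1+q^]²-expand k k f m ⟩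
    (f m +₂ (q^ k · f) m) +₂ ((q^ k · f) m +₂ (q^ k · q^ k · f) m)
      ≡⟨ +₂-cancel-middle (f m) _ _ ⟩
    f m +₂ (q^ k · q^ k · f) m
      ≡⟨ cong (f m +₂_) (q^-q^ k k f m) ⟩
    f m +₂ (q^ (k + k) · f) m
      ≡⟨ cong (λ e → f m +₂ (q^ e · f) m) (cong (_+_ k) (+-identityʳ k)) ⟨
    f m +₂ (q^ (2 * k) · f) m
      ≡⟨ [1+q^]-coeff (2 * k) f m ⟨
    ([1+q^ (2 * k) ]· f) m ∎
    where open ≡-Reasoning

  infixr 8 [1+q^_]^_·_

  [1+q^_]^_·_ : ℕ → ℕ → Series₂ → Series₂
  [1+q^ k ]^ zero  · f = f
  [1+q^ k ]^ suc e · f = [1+q^ k ]· [1+q^ k ]^ e · f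

  [1+q^]^-cong : ∀ k e {f g} → f ≗ g → [1+q^ k ]^ e · f ≗ [1+q^ k ]^ e · g
  [1+q^]^-cong k zero    f≗g = f≗g
  [1+q^]^-cong k (suc e) f≗g = [1+q^]-cong k ([1+q^]^-cong k e f≗g)

  [1+q^]^-suc : ∀ k e f → [1+q^ k ]^ e · [1+q^ k ]· f ≗ [1+q^ k ]^ suc e · f
  [1+q^]^-suc k zero    f m = refl
  [1+q^]^-suc k (suc e) f m = [1+q^]-cong k ([1+q^]^-suc k e f) m

  [1+q^]^-double : ∀ k e f → [1+q^ k ]^ 2 * e · f ≗ [1+q^ 2 * k ]^ e · f
  [1+q^]^-double k zero    f m = refl
  [1+q^]^-double k (suc e) f m = begin
    ([1+q^ k ]^ 2 * suc e · f) m                      ≡⟨ cong (λ d → ([1+q^ k ]^ d · f) m) (*-suc 2 e) ⟩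
    ([1+q^ k ]· [1+q^ k ]· [1+q^ k ]^ 2 * e · f) m     ≡⟨ [1+q^]-frobenius k _ m ⟩
    ([1+q^ 2 * k ]· [1+q^ k ]^ 2 * e · f) m           ≡⟨ [1+q^]-cong (2 * k) ([1+q^]^-double k e f) m ⟩
    ([1+q^ 2 * k ]· [1+q^ 2 * k ]^ e · f) m           ∎
    where open ≡-Reasoning

  [1+q^]^8 : ∀ k f → [1+q^ k ]^ 8 · f ≗ [1+q^ 8 * k ]· f
  [1+q^]^8 k f m = begin
    ([1+q^ k ]^ 2 * 4 · f) m             ≡⟨ [1+q^]^-double k 4 f m ⟩
    ([1+q^ 2 * k ]^ 2 * 2 · f) m         ≡⟨ [1+q^]^-double (2 * k) 2 f m ⟩
    ([1+q^ 2 * (2 * k) ]^ 2 * 1 · f) m   ≡⟨ [1+q^]^-double (2 * (2 * k)) 1 f m ⟩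
    ([1+q^ 2 * (2 * (2 * k)) ]· f) m     ≡⟨ cong (λ e → ([1+q^ e ]· f) m) (eight k) ⟩
    ([1+q^ 8 * k ]· f) m                 ∎
    where
    open ≡-Reasoning
    eight : ∀ k → 2 * (2 * (2 * k)) ≡ 8 * k
    eight = solve-∀

  [1+q^]^24 : ∀ k f → [1+q^ k ]^ 24 · f ≗ [1+q^ 8 * k ]· [1+q^ 16 * k ]· f
  [1+q^]^24 k f m = begin
    ([1+q^ k ]^ 2 * 12 · f) m               ≡⟨ [1+q^]^-double k 12 f m ⟩
    ([1+q^ 2 * k ]^ 2 * 6 · f) m            ≡⟨ [1+q^]^-double (2 * k) 6 f m ⟩
    ([1+q^ 2 * (2 * k) ]^ 2 * 3 · f) m      ≡⟨ [1+q^]^-double (2 * (2 * k)) 3 f m ⟩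
    ([1+q^ K ]· [1+q^ K ]· [1+q^ K ]· f) m  ≡⟨ [1+q^]-cong K ([1+q^]-frobenius K f) m ⟩
    ([1+q^ K ]· [1+q^ 2 * K ]· f) m         ≡⟨ cong₂ (λ a b → ([1+q^ a ]· [1+q^ b ]· f) m) (eight k) (sixteen k) ⟩
    ([1+q^ 8 * k ]· [1+q^ 16 * k ]· f) m    ∎
    where
    open ≡-Reasoning
    K = 2 * (2 * (2 * k))
    eight : ∀ k → 2 * (2 * (2 * k)) ≡ 8 * k
    eight = solve-∀
    sixteen : ∀ k → 2 * (2 * (2 * (2 * k))) ≡ 16 * k
    sixteen = solve-∀

  infixr 8 ∏[1+q^_]<_·_

  ∏[1+q^_]<_·_ : (ℕ → ℕ) → ℕ → Series₂ → Series₂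
  ∏[1+q^ φ ]< zero  · f = f
  ∏[1+q^ φ ]< suc n · f = [1+q^ φ n ]· ∏[1+q^ φ ]< n · f

  ∏-cong : ∀ φ n {f g} → f ≗ g → ∏[1+q^ φ ]< n · f ≗ ∏[1+q^ φ ]< n · g
  ∏-cong φ zero    f≗g = f≗g
  ∏-cong φ (suc n) f≗g = [1+q^]-cong (φ n) (∏-cong φ n f≗g)

  ∏-cong-exponents : ∀ {φ ψ} n f → φ ≗ ψ → ∏[1+q^ φ ]< n · f ≗ ∏[1+q^ ψ ]< n · f
  ∏-cong-exponents         zero    f φ≗ψ m = refl
  ∏-cong-exponents {φ} {ψ} (suc n) f φ≗ψ m =
    trans (cong (λ e → ([1+q^ e ]· ∏[1+q^ φ ]< n · f) m) (φ≗ψ n))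
          ([1+q^]-cong (ψ n) (∏-cong-exponents n f φ≗ψ) m)

  ∏-≗[≤] : ∀ φ n {M f g} → f ≗[≤ M ] g → ∏[1+q^ φ ]< n · f ≗[≤ M ] ∏[1+q^ φ ]< n · g
  ∏-≗[≤] φ zero    f≗g = f≗g
  ∏-≗[≤] φ (suc n) f≗g = [1+q^]-≗[≤] (φ n) (∏-≗[≤] φ n f≗g)

  ∏-distrib-⊕ : ∀ φ n f g → ∏[1+q^ φ ]< n · (f ⊕ g) ≗ ∏[1+q^ φ ]< n · f ⊕ ∏[1+q^ φ ]< n · g
  ∏-distrib-⊕ φ zero    f g m = refl
  ∏-distrib-⊕ φ (suc n) f g m = trans ([1+q^]-cong (φ n) (∏-distrib-⊕ φ n f g) m)
                                      ([1+q^]-distrib-⊕ (φ n) _ _ m)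

  ∏-q^ : ∀ φ n e f → ∏[1+q^ φ ]< n · q^ e · f ≗ q^ e · ∏[1+q^ φ ]< n · f
  ∏-q^ φ zero    e f m = refl
  ∏-q^ φ (suc n) e f m = trans ([1+q^]-cong (φ n) (∏-q^ φ n e f) m) ([1+q^]-q^ (φ n) e _ m)

  [1+q^]-∏ : ∀ k φ n f → [1+q^ k ]· ∏[1+q^ φ ]< n · f ≗ ∏[1+q^ φ ]< n · [1+q^ k ]· f
  [1+q^]-∏ k φ zero    f m = refl
  [1+q^]-∏ k φ (suc n) f m = trans ([1+q^]-comm k (φ n) _ m) ([1+q^]-cong (φ n) ([1+q^]-∏ k φ n f) m)

  ∏-frobenius : ∀ φ n f → ∏[1+q^ φ ]< n · ∏[1+q^ φ ]< n · f ≗ ∏[1+q^ (λ i → 2 * φ i) ]< n · f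
  ∏-frobenius φ zero    f m = refl
  ∏-frobenius φ (suc n) f m = begin
    ([1+q^ φ n ]· ∏[1+q^ φ ]< n · [1+q^ φ n ]· P) m  ≡⟨ [1+q^]-cong (φ n) ([1+q^]-∏ (φ n) φ n P) m ⟨
    ([1+q^ φ n ]· [1+q^ φ n ]· ∏[1+q^ φ ]< n · P) m  ≡⟨ [1+q^]-frobenius (φ n) (∏[1+q^ φ ]< n · P) m ⟩
    ([1+q^ 2 * φ n ]· ∏[1+q^ φ ]< n · P) m           ≡⟨ [1+q^]-cong (2 * φ n) (∏-frobenius φ n f) m ⟩
    ([1+q^ 2 * φ n ]· ∏[1+q^ (λ i → 2 * φ i) ]< n · f) m ∎
    where
    open ≡-Reasoning
    P = ∏[1+q^ φ ]< n · f

  ∏-first : ∀ φ n f → ∏[1+q^ φ ]< suc n · f ≗ [1+q^ φ 0 ]· ∏[1+q^ φ ∘ suc ]< n · f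
  ∏-first φ zero    f m = refl
  ∏-first φ (suc n) f m = begin
    ([1+q^ φ (suc n) ]· [1+q^ φ n ]· ∏[1+q^ φ ]< n · f) m
      ≡⟨ [1+q^]-cong (φ (suc n)) (∏-first φ n f) m ⟩
    ([1+q^ φ (suc n) ]· [1+q^ φ 0 ]· ∏[1+q^ φ ∘ suc ]< n · f) m
      ≡⟨ [1+q^]-comm (φ (suc n)) (φ 0) _ m ⟩
    ([1+q^ φ 0 ]· [1+q^ φ (suc n) ]· ∏[1+q^ φ ∘ suc ]< n · f) m ∎
    where open ≡-Reasoning

  ∏-drop : ∀ φ d n {M} f → (∀ {j} → j < d → M < φ (j + n)) →
           ∏[1+q^ φ ]< d + n · f ≗[≤ M ] ∏[1+q^ φ ]< n · f
  ∏-drop φ zero    n f large m≤M = refl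
  ∏-drop φ (suc d) n f large m≤M =
    trans ([1+q^]-below (φ (d + n)) _ (≤-<-trans m≤M (large ≤-refl)))
          (∏-drop φ d n f (λ j<d → large (m≤n⇒m≤1+n j<d)) m≤M)

  ∏-cancel : ∀ φ n M {f g} → (∀ i → 0 < φ i) →
             ∏[1+q^ φ ]< n · f ≗[≤ M ] ∏[1+q^ φ ]< n · g → f ≗[≤ M ] g
  ∏-cancel φ zero    M φ>0 eq = eq
  ∏-cancel φ (suc n) M φ>0 eq = ∏-cancel φ n M φ>0 ([1+q^]-cancel (φ n) M (φ>0 n) eq)

  multiples oddMultiples : ℕ → ℕ → ℕ
  multiples    c i = c * suc i
  oddMultiples c i = c * suc (2 * i)

  ∏-split : ∀ c n f → ∏[1+q^ multiples c ]< 2 * n · f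
                    ≗ ∏[1+q^ oddMultiples c ]< n · ∏[1+q^ multiples (2 * c) ]< n · f
  ∏-split c zero    f m = refl
  ∏-split c (suc n) f m = begin
    (∏[1+q^ multiples c ]< 2 * suc n · f) m
      ≡⟨ cong (λ N → (∏[1+q^ multiples c ]< N · f) m) (*-suc 2 n) ⟩
    ([1+q^ c * suc (suc (2 * n)) ]· [1+q^ oddMultiples c n ]· ∏[1+q^ multiples c ]< 2 * n · f) m
      ≡⟨ cong (λ e → ([1+q^ e ]· [1+q^ oddMultiples c n ]· ∏[1+q^ multiples c ]< 2 * n · f) m) (even c n) ⟩
    ([1+q^ multiples (2 * c) n ]· [1+q^ oddMultiples c n ]· ∏[1+q^ multiples c ]< 2 * n · f) m
      ≡⟨ [1+q^]-comm _ (oddMultiples c n) _ m ⟩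
    ([1+q^ oddMultiples c n ]· [1+q^ multiples (2 * c) n ]· ∏[1+q^ multiples c ]< 2 * n · f) m
      ≡⟨ [1+q^]-cong (oddMultiples c n) ([1+q^]-cong (multiples (2 * c) n) (∏-split c n f)) m ⟩
    ([1+q^ oddMultiples c n ]· [1+q^ multiples (2 * c) n ]· ∏[1+q^ oddMultiples c ]< n · Q) m
      ≡⟨ [1+q^]-cong (oddMultiples c n) ([1+q^]-∏ (multiples (2 * c) n) (oddMultiples c) n Q) m ⟩
    ([1+q^ oddMultiples c n ]· ∏[1+q^ oddMultiples c ]< n · [1+q^ multiples (2 * c) n ]· Q) m ∎
    where
    open ≡-Reasoning
    Q = ∏[1+q^ multiples (2 * c) ]< n · f
    even : ∀ c n → c * suc (suc (2 * n)) ≡ 2 * c * suc n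
    even = solve-∀

  ∏multiples-drop : ∀ c n f .{{_ : NonZero c}} →
                    ∏[1+q^ multiples c ]< 2 * n · f ≗[≤ n ] ∏[1+q^ multiples c ]< n · f
  ∏multiples-drop c n f {m} m≤n = begin
    (∏[1+q^ multiples c ]< 2 * n · f) m
      ≡⟨ cong (λ N → (∏[1+q^ multiples c ]< n + N · f) m) (+-identityʳ n) ⟩
    (∏[1+q^ multiples c ]< n + n · f) m
      ≡⟨ ∏-drop (multiples c) n n f (λ {j} _ → <-≤-trans (s≤s (m≤n+m n j)) (m≤n*m _ c)) m≤n ⟩
    (∏[1+q^ multiples c ]< n · f) m ∎
    where open ≡-Reasoning

  infixr 8 ∏[1+q^_]<_from_·_

  ∏[1+q^_]<_from_·_ : (ℕ → ℕ) → ℕ → ℕ → Series₂ → Series₂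
  ∏[1+q^ ψ ]< n from k · f = ∏[1+q^ (λ i → ψ (k + i)) ]< n ∸ k · f

  ∏from-empty : ∀ ψ n f → ∏[1+q^ ψ ]< n from n · f ≗ f
  ∏from-empty ψ n f m = cong (λ r → (∏[1+q^ (λ i → ψ (n + i)) ]< r · f) m) (n∸n≡0 n)

  ∏from-last : ∀ ψ {k n} f → k ≤ n →
               ∏[1+q^ ψ ]< suc n from k · f ≗ [1+q^ ψ n ]· ∏[1+q^ ψ ]< n from k · f
  ∏from-last ψ {k} {n} f k≤n m = begin
    (∏[1+q^ ψ′ ]< suc n ∸ k · f) m
      ≡⟨ cong (λ r → (∏[1+q^ ψ′ ]< r · f) m) (+-∸-assoc 1 k≤n) ⟩
    ([1+q^ ψ (k + (n ∸ k)) ]· ∏[1+q^ ψ′ ]< n ∸ k · f) m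
      ≡⟨ cong (λ i → ([1+q^ ψ i ]· ∏[1+q^ ψ′ ]< n ∸ k · f) m) (m+[n∸m]≡n k≤n) ⟩
    ([1+q^ ψ n ]· ∏[1+q^ ψ′ ]< n ∸ k · f) m ∎
    where
    open ≡-Reasoning
    ψ′ = λ i → ψ (k + i)

  ∏from-first : ∀ ψ {k n} f → k < n →
                ∏[1+q^ ψ ]< n from k · f ≗ [1+q^ ψ k ]· ∏[1+q^ ψ ]< n from suc k · f
  ∏from-first ψ {k} {suc n} f (s≤s k≤n) m = begin
    (∏[1+q^ ψ′ ]< suc n ∸ k · f) m
      ≡⟨ cong (λ r → (∏[1+q^ ψ′ ]< r · f) m) (+-∸-assoc 1 k≤n) ⟩
    (∏[1+q^ ψ′ ]< suc (n ∸ k) · f) m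
      ≡⟨ ∏-first ψ′ (n ∸ k) f m ⟩
    ([1+q^ ψ (k + 0) ]· ∏[1+q^ ψ′ ∘ suc ]< n ∸ k · f) m
      ≡⟨ cong (λ i → ([1+q^ ψ i ]· ∏[1+q^ ψ′ ∘ suc ]< n ∸ k · f) m) (+-identityʳ k) ⟩
    ([1+q^ ψ k ]· ∏[1+q^ ψ′ ∘ suc ]< n ∸ k · f) m
      ≡⟨ [1+q^]-cong (ψ k) (∏-cong-exponents (n ∸ k) f (λ i → cong ψ (+-suc k i))) m ⟩
    ([1+q^ ψ k ]· ∏[1+q^ (λ i → ψ (suc k + i)) ]< n ∸ k · f) m ∎
    where
    open ≡-Reasoning
    ψ′ = λ i → ψ (k + i)

  infixl 7 _⊛₂_

  _⊛₂_ : Series₂ → Series₂ → Series₂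
  (F ⊛₂ G) m = ∑< (suc m) (λ i → F i *₂ G (m ∸ i))

  ⊛₂-congʳ : ∀ F {G H} → G ≗ H → F ⊛₂ G ≗ F ⊛₂ H
  ⊛₂-congʳ F G≗H m = ∑<-cong (suc m) (λ {i} _ → cong (F i *₂_) (G≗H (m ∸ i)))

  ⊛₂-identityʳ : ∀ F → F ⊛₂ 1₂ ≗ F
  ⊛₂-identityʳ F m = begin
    ∑< (suc m) (λ i → F i *₂ 1₂ (m ∸ i))
      ≡⟨ ∑<-suc m _ ⟩
    ∑< m (λ i → F i *₂ 1₂ (m ∸ i)) +₂ (F m *₂ 1₂ (m ∸ m))
      ≡⟨ cong₂ _+₂_ (∑<-zero m off-diagonal) (cong (λ x → F m *₂ 1₂ x) (n∸n≡0 m)) ⟩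
    0ℙ +₂ (F m *₂ 1ℙ)
      ≡⟨ ℙ.*-identityʳ (F m) ⟩
    F m ∎
    where
    open ≡-Reasoning
    1₂-positive : ∀ {x} → 0 < x → 1₂ x ≡ 0ℙ
    1₂-positive (s≤s _) = refl
    off-diagonal : ∀ {i} → i < m → F i *₂ 1₂ (m ∸ i) ≡ 0ℙ
    off-diagonal {i} i<m = trans (cong (F i *₂_) (1₂-positive (m<n⇒0<n∸m i<m))) (ℙ.*-zeroʳ (F i))

  ⊛₂-distribˡ-⊕ : ∀ F G H → F ⊛₂ (G ⊕ H) ≗ F ⊛₂ G ⊕ F ⊛₂ H
  ⊛₂-distribˡ-⊕ F G H m =
    trans (∑<-cong (suc m) (λ {i} _ → ℙ.*-distribˡ-+ (F i) (G (m ∸ i)) (H (m ∸ i))))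
          (∑<-+ (suc m) (λ i → F i *₂ G (m ∸ i)) (λ i → F i *₂ H (m ∸ i)))

  ⊛₂-q^ : ∀ F k G → F ⊛₂ q^ k · G ≗ q^ k · (F ⊛₂ G)
  ⊛₂-q^ F zero    G m       = refl
  ⊛₂-q^ F (suc k) G zero    = ∑<-zero 1 (λ { (s≤s z≤n) → ℙ.*-zeroʳ (F 0) })
  ⊛₂-q^ F (suc k) G (suc m) = begin
    ∑< (suc (suc m)) (λ i → F i *₂ (q^ suc k · G) (suc m ∸ i))
      ≡⟨ ∑<-suc (suc m) _ ⟩
    ∑< (suc m) (λ i → F i *₂ (q^ suc k · G) (suc m ∸ i)) +₂ (F (suc m) *₂ (q^ suc k · G) (m ∸ m))
      ≡⟨ cong₂ _+₂_ (∑<-cong (suc m) unshift) last-vanishes ⟩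
    (F ⊛₂ q^ k · G) m +₂ 0ℙ
      ≡⟨ ℙ.+-identityʳ _ ⟩
    (F ⊛₂ q^ k · G) m
      ≡⟨ ⊛₂-q^ F k G m ⟩
    (q^ k · (F ⊛₂ G)) m ∎
    where
    open ≡-Reasoning
    unshift : ∀ {i} → i < suc m → F i *₂ (q^ suc k · G) (suc m ∸ i) ≡ F i *₂ (q^ k · G) (m ∸ i)
    unshift {i} (s≤s i≤m) = cong (λ x → F i *₂ (q^ suc k · G) x) (+-∸-assoc 1 i≤m)
    last-vanishes : F (suc m) *₂ (q^ suc k · G) (m ∸ m) ≡ 0ℙ
    last-vanishes = trans (cong (λ x → F (suc m) *₂ (q^ suc k · G) x) (n∸n≡0 m)) (ℙ.*-zeroʳ (F (suc m)))

  ⊛₂-[1+q^] : ∀ F k G → F ⊛₂ [1+q^ k ]· G ≗ [1+q^ k ]· (F ⊛₂ G)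
  ⊛₂-[1+q^] F k G m = begin
    (F ⊛₂ [1+q^ k ]· G) m              ≡⟨ ⊛₂-congʳ F ([1+q^]-coeff k G) m ⟩
    (F ⊛₂ (G ⊕ q^ k · G)) m            ≡⟨ ⊛₂-distribˡ-⊕ F G (q^ k · G) m ⟩
    (F ⊛₂ G) m +₂ (F ⊛₂ q^ k · G) m    ≡⟨ cong ((F ⊛₂ G) m +₂_) (⊛₂-q^ F k G m) ⟩
    (F ⊛₂ G) m +₂ (q^ k · (F ⊛₂ G)) m  ≡⟨ [1+q^]-coeff k (F ⊛₂ G) m ⟨
    ([1+q^ k ]· (F ⊛₂ G)) m            ∎
    where open ≡-Reasoning

  ⊛₂-[1+q^]^ : ∀ F k e G → F ⊛₂ [1+q^ k ]^ e · G ≗ [1+q^ k ]^ e · (F ⊛₂ G)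
  ⊛₂-[1+q^]^ F k zero    G m = refl
  ⊛₂-[1+q^]^ F k (suc e) G m =
    trans (⊛₂-[1+q^] F k _ m) ([1+q^]-cong k (⊛₂-[1+q^]^ F k e G) m)

  parityℤ-⊛ : ∀ f g → parityℤ ∘ (f ⊛ g) ≗ (parityℤ ∘ f) ⊛₂ (parityℤ ∘ g)
  parityℤ-⊛ f g m = begin
    parityℤ (sumℤ (map h (upTo (suc m))))  ≡⟨ cong (parityℤ ∘ sumℤ) (map-applyUpTo id h (suc m)) ⟩
    parityℤ (sumℤ (applyUpTo h (suc m)))   ≡⟨ parityℤ-sumℤ (suc m) h ⟩
    ∑< (suc m) (parityℤ ∘ h)               ≡⟨ ∑<-cong (suc m) (λ {i} _ → parityℤ-homo-* (f i) (g (m ∸ i))) ⟩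
    ((parityℤ ∘ f) ⊛₂ (parityℤ ∘ g)) m     ∎
    where
    open ≡-Reasoning
    h : ℕ → ℤ
    h i = f i ℤ.* g (m ∸ i)

  parityℤ-one : parityℤ ∘ one ≗ 1₂
  parityℤ-one zero    = refl
  parityℤ-one (suc m) = refl

  parityℤ-oneMinusQ^ : ∀ k → 0 < k → parityℤ ∘ oneMinusQ^ k ≗ [1+q^ k ]· 1₂
  parityℤ-oneMinusQ^ (suc k) _ zero    = sym ([1+q^]-coeff (suc k) 1₂ 0)
  parityℤ-oneMinusQ^ (suc k) _ (suc j) = begin
    parityℤ (oneMinusQ^ (suc k) (suc j))  ≡⟨ if-float parityℤ (j ≡ᵇ k) ⟩
    (if j ≡ᵇ k then 1ℙ else 0ℙ)           ≡⟨ q^·1₂-coeff k j ⟨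
    (q^ k · 1₂) j                         ≡⟨ [1+q^]-coeff (suc k) 1₂ (suc j) ⟨
    ([1+q^ suc k ]· 1₂) (suc j)           ∎
    where open ≡-Reasoning

  parityℤ-⊛-^ˢ : ∀ f k e → 0 < k →
                 parityℤ ∘ (f ⊛ (oneMinusQ^ k ^ˢ e)) ≗ [1+q^ k ]^ e · (parityℤ ∘ f)

  parityℤ-^ˢ : ∀ k e → 0 < k → parityℤ ∘ (oneMinusQ^ k ^ˢ e) ≗ [1+q^ k ]^ e · 1₂
  parityℤ-^ˢ k zero    k>0 = parityℤ-one
  parityℤ-^ˢ k (suc e) k>0 m = begin
    parityℤ ((u ⊛ (u ^ˢ e)) m)         ≡⟨ parityℤ-⊛-^ˢ u k e k>0 m ⟩
    ([1+q^ k ]^ e · (parityℤ ∘ u)) m   ≡⟨ [1+q^]^-cong k e (parityℤ-oneMinusQ^ k k>0) m ⟩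
    ([1+q^ k ]^ e · [1+q^ k ]· 1₂) m   ≡⟨ [1+q^]^-suc k e 1₂ m ⟩
    ([1+q^ k ]^ suc e · 1₂) m          ∎
    where
    open ≡-Reasoning
    u = oneMinusQ^ k

  parityℤ-⊛-^ˢ f k e k>0 m = begin
    parityℤ ((f ⊛ (u ^ˢ e)) m)                 ≡⟨ parityℤ-⊛ f (u ^ˢ e) m ⟩
    ((parityℤ ∘ f) ⊛₂ (parityℤ ∘ (u ^ˢ e))) m  ≡⟨ ⊛₂-congʳ (parityℤ ∘ f) (parityℤ-^ˢ k e k>0) m ⟩
    ((parityℤ ∘ f) ⊛₂ [1+q^ k ]^ e · 1₂) m     ≡⟨ ⊛₂-[1+q^]^ (parityℤ ∘ f) k e 1₂ m ⟩
    ([1+q^ k ]^ e · ((parityℤ ∘ f) ⊛₂ 1₂)) m   ≡⟨ [1+q^]^-cong k e (⊛₂-identityʳ (parityℤ ∘ f)) m ⟩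
    ([1+q^ k ]^ e · (parityℤ ∘ f)) m           ∎
    where
    open ≡-Reasoning
    u = oneMinusQ^ k

  parityℤ-prodUpTo-3-8 : ∀ n → parityℤ ∘ prodUpTo 3 8 n ≗ ∏[1+q^ multiples 24 ]< n · 1₂
  parityℤ-prodUpTo-3-8 zero      = parityℤ-one
  parityℤ-prodUpTo-3-8 (suc n) m = begin
    parityℤ (prodUpTo 3 8 (suc n) m)          ≡⟨ parityℤ-⊛-^ˢ (prodUpTo 3 8 n) (3 * suc n) 8 (s≤s z≤n) m ⟩
    ([1+q^ 3 * suc n ]^ 8 · P) m              ≡⟨ [1+q^]^8 (3 * suc n) P m ⟩
    ([1+q^ 8 * (3 * suc n) ]· P) m            ≡⟨ cong (λ e → ([1+q^ e ]· P) m) (*-assoc 8 3 (suc n)) ⟨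
    ([1+q^ 24 * suc n ]· P) m                 ≡⟨ [1+q^]-cong (24 * suc n) (parityℤ-prodUpTo-3-8 n) m ⟩
    (∏[1+q^ multiples 24 ]< suc n · 1₂) m     ∎
    where
    open ≡-Reasoning
    P = parityℤ ∘ prodUpTo 3 8 n

  parityℤ-prodUpTo-1-24 : ∀ n → parityℤ ∘ prodUpTo 1 24 n
                                ≗ ∏[1+q^ multiples 8 ]< n · ∏[1+q^ multiples 16 ]< n · 1₂
  parityℤ-prodUpTo-1-24 zero      = parityℤ-one
  parityℤ-prodUpTo-1-24 (suc n) m = begin
    parityℤ (prodUpTo 1 24 (suc n) m)
      ≡⟨ parityℤ-⊛-^ˢ (prodUpTo 1 24 n) (1 * suc n) 24 (s≤s z≤n) m ⟩
    ([1+q^ 1 * suc n ]^ 24 · P) m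
      ≡⟨ [1+q^]^24 (1 * suc n) P m ⟩
    ([1+q^ 8 * (1 * suc n) ]· [1+q^ 16 * (1 * suc n) ]· P) m
      ≡⟨ cong (λ k → ([1+q^ 8 * k ]· [1+q^ 16 * k ]· P) m) (*-identityˡ (suc n)) ⟩
    ([1+q^ 8 * suc n ]· [1+q^ 16 * suc n ]· P) m
      ≡⟨ [1+q^]-cong (8 * suc n) ([1+q^]-cong (16 * suc n) (parityℤ-prodUpTo-1-24 n)) m ⟩
    ([1+q^ 8 * suc n ]· [1+q^ 16 * suc n ]· ∏[1+q^ multiples 8 ]< n · Q) m
      ≡⟨ [1+q^]-cong (8 * suc n) ([1+q^]-∏ (16 * suc n) (multiples 8) n Q) m ⟩
    ([1+q^ 8 * suc n ]· ∏[1+q^ multiples 8 ]< n · [1+q^ 16 * suc n ]· Q) m ∎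
    where
    open ≡-Reasoning
    P = parityℤ ∘ prodUpTo 1 24 n
    Q = ∏[1+q^ multiples 16 ]< n · 1₂

  triangular : ℕ → ℕ
  triangular zero    = 0
  triangular (suc k) = suc k + triangular k

  -- The pentagonal numbers k(3k − 1)/2 and k(3k + 1)/2 at k = j + 1.
  pentagonal⁻ pentagonal⁺ : ℕ → ℕ
  pentagonal⁻ j = triangular j + suc j * suc j
  pentagonal⁺ j = suc j * suc j + triangular (suc j)

  2*triangular : ∀ k → 2 * triangular k ≡ k * suc k
  2*triangular zero    = refl
  2*triangular (suc k) = begin
    2 * (suc k + triangular k)     ≡⟨ *-distribˡ-+ 2 (suc k) (triangular k) ⟩
    2 * suc k + 2 * triangular k   ≡⟨ cong (2 * suc k +_) (2*triangular k) ⟩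
    2 * suc k + k * suc k          ≡⟨ *-distribʳ-+ (suc k) 2 k ⟨
    suc (suc k) * suc k            ≡⟨ *-comm (suc (suc k)) (suc k) ⟩
    suc k * suc (suc k)            ∎
    where open ≡-Reasoning

  triangular≡ : ∀ k t → 2 * t ≡ k * suc k → triangular k ≡ t
  triangular≡ k t 2t≡ = *-cancelˡ-≡ (triangular k) t 2 (trans (2*triangular k) (sym 2t≡))

  triangular-affine : ∀ k n a b → 2 * a + b * (n * suc n) ≡ k * suc k →
                      triangular k ≡ a + b * triangular n
  triangular-affine k n a b closed = triangular≡ k (a + b * triangular n) (begin
    2 * (a + b * triangular n)       ≡⟨ distrib a b (triangular n) ⟩
    2 * a + b * (2 * triangular n)   ≡⟨ cong (λ x → 2 * a + b * x) (2*triangular n) ⟩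
    2 * a + b * (n * suc n)          ≡⟨ closed ⟩
    k * suc k                        ∎)
    where
    open ≡-Reasoning
    distrib : ∀ a b t → 2 * (a + b * t) ≡ 2 * a + b * (2 * t)
    distrib = solve-∀

  triangular-odd : ∀ n → triangular (suc (2 * n)) ≡ suc n * suc (2 * n)
  triangular-odd n = triangular≡ (suc (2 * n)) _ (closed n)
    where
    closed : ∀ n → 2 * (suc n * suc (2 * n)) ≡ suc (2 * n) * suc (suc (2 * n))
    closed = solve-∀

  triangular-even : ∀ n → triangular (suc (suc (2 * n))) ≡ suc n * suc (2 * suc n)
  triangular-even n = triangular≡ (suc (suc (2 * n))) _ (closed n)
    where
    closed : ∀ n → 2 * (suc n * suc (2 * suc n)) ≡ suc (suc (2 * n)) * suc (suc (suc (2 * n)))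
    closed = solve-∀

  triangular-3n+1 : ∀ n → triangular (suc (3 * n)) ≡ suc (9 * triangular n)
  triangular-3n+1 n = triangular-affine (suc (3 * n)) n 1 9 (closed n)
    where
    closed : ∀ n → 2 * 1 + 9 * (n * suc n) ≡ suc (3 * n) * suc (suc (3 * n))
    closed = solve-∀

  triangular-3n+2 : ∀ n → triangular (suc (suc (3 * n))) ≡ 3 * pentagonal⁻ n
  triangular-3n+2 n =
    trans (triangular-affine (suc (suc (3 * n))) n (3 * (suc n * suc n)) 3 (closed n))
          (regroup n (triangular n))
    where
    closed : ∀ n → 2 * (3 * (suc n * suc n)) + 3 * (n * suc n)
                 ≡ suc (suc (3 * n)) * suc (suc (suc (3 * n)))
    closed = solve-∀
    regroup : ∀ n t → 3 * (suc n * suc n) + 3 * t ≡ 3 * (t + suc n * suc n)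
    regroup = solve-∀

  triangular-3n+3 : ∀ n → triangular (suc (suc (suc (3 * n)))) ≡ 3 * pentagonal⁺ n
  triangular-3n+3 n =
    trans (triangular-affine (suc (suc (suc (3 * n)))) n (3 * (suc n * suc (suc n))) 3 (closed n))
          (regroup n (triangular n))
    where
    closed : ∀ n → 2 * (3 * (suc n * suc (suc n))) + 3 * (n * suc n)
                 ≡ suc (suc (suc (3 * n))) * suc (suc (suc (suc (3 * n))))
    closed = solve-∀
    regroup : ∀ n t → 3 * (suc n * suc (suc n)) + 3 * t ≡ 3 * (suc n * suc n + (suc n + t))
    regroup = solve-∀

  8*triangular-3n+1 : ∀ j → 8 * triangular (suc (3 * j)) ≡ 8 + 9 * (8 * triangular j)
  8*triangular-3n+1 j = trans (cong (8 *_) (triangular-3n+1 j)) (expand (triangular j))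
    where
    expand : ∀ t → 8 * suc (9 * t) ≡ 8 + 9 * (8 * t)
    expand = solve-∀

  eulerSum : ℕ → ℕ → Series₂
  eulerSum d zero    = 1₂
  eulerSum d (suc n) = eulerSum d n ⊕ q^ d * pentagonal⁻ n · 1₂ ⊕ q^ d * pentagonal⁺ n · 1₂

  module _ (d : ℕ) where

    private
      W : ℕ → ℕ → Series₂
      W n k = ∏[1+q^ multiples d ]< n from k · 1₂

    -- The terms of Shanks' finite form of Euler's identity (with q ↦ q^d); the step
    -- n → n + 1 telescopes through eulerPartner.
    eulerTerm : ℕ → ℕ → Series₂
    eulerTerm n k = q^ d * (n * k + triangular k) · W n k

    eulerPartner : ℕ → ℕ → Series₂
    eulerPartner n zero    = 0₂
    eulerPartner n (suc k) = q^ d * (triangular k + suc n * suc k) · W n k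

    eulerTerm-suc : ∀ {n k} → k ≤ n → eulerTerm (suc n) k
                  ≗ q^ d * (suc n * k + triangular k) · W n k ⊕ q^ d * (triangular k + suc n * suc k) · W n k
    eulerTerm-suc {n} {k} k≤n m = begin
      (q^ α · W (suc n) k) m
        ≡⟨ q^-cong α (∏from-last (multiples d) 1₂ k≤n) m ⟩
      (q^ α · [1+q^ d * suc n ]· W n k) m
        ≡⟨ q^·[1+q^] α (d * suc n) (W n k) m ⟩
      (q^ α · W n k) m +₂ (q^ α + d * suc n · W n k) m
        ≡⟨ cong (λ e → (q^ α · W n k) m +₂ (q^ e · W n k) m) (exponent d n k (triangular k)) ⟩
      (q^ α · W n k) m +₂ (q^ β · W n k) m ∎
      where
      open ≡-Reasoning
      α = d * (suc n * k + triangular k)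
      β = d * (triangular k + suc n * suc k)
      exponent : ∀ d n k t → d * (suc n * k + t) + d * suc n ≡ d * (t + suc n * suc k)
      exponent = solve-∀

    eulerPartner-≗ : ∀ {n k} → k ≤ n → eulerPartner n k
                   ≗ q^ d * (n * k + triangular k) · W n k ⊕ q^ d * (suc n * k + triangular k) · W n k
    eulerPartner-≗ {n} {zero}  _   m = sym (ℙ.p+p≡0ℙ ((q^ d * (n * 0 + 0) · W n 0) m))
    eulerPartner-≗ {n} {suc k} k<n m = begin
      (q^ e · W n k) m
        ≡⟨ q^-cong e (∏from-first (multiples d) 1₂ k<n) m ⟩
      (q^ e · [1+q^ d * suc k ]· W n (suc k)) m
        ≡⟨ q^·[1+q^] e (d * suc k) (W n (suc k)) m ⟩
      (q^ e · W n (suc k)) m +₂ (q^ e + d * suc k · W n (suc k)) m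
        ≡⟨ cong₂ (λ a b → (q^ a · W n (suc k)) m +₂ (q^ b · W n (suc k)) m) (lower d n k t) (upper d n k t) ⟩
      (q^ γ · W n (suc k)) m +₂ (q^ α · W n (suc k)) m ∎
      where
      open ≡-Reasoning
      e = d * (triangular k + suc n * suc k)
      γ = d * (n * suc k + triangular (suc k))
      α = d * (suc n * suc k + triangular (suc k))
      t = triangular k
      lower : ∀ d n k t → d * (t + suc n * suc k) ≡ d * (n * suc k + (suc k + t))
      lower = solve-∀
      upper : ∀ d n k t → d * (t + suc n * suc k) + d * suc k ≡ d * (suc n * suc k + (suc k + t))
      upper = solve-∀

    eulerTerm-step : ∀ {n k} → k ≤ n →
      eulerTerm (suc n) k ⊕ eulerTerm n k ≗ eulerPartner n k ⊕ eulerPartner n (suc k)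
    eulerTerm-step {n} {k} k≤n m = begin
      eulerTerm (suc n) k m +₂ eulerTerm n k m
        ≡⟨ cong (_+₂ eulerTerm n k m) (eulerTerm-suc k≤n m) ⟩
      (q^ α · W n k) m +₂ (q^ β · W n k) m +₂ (q^ γ · W n k) m
        ≡⟨ xy∙z≈zx∙y ((q^ α · W n k) m) ((q^ β · W n k) m) ((q^ γ · W n k) m) ⟩
      (q^ γ · W n k) m +₂ (q^ α · W n k) m +₂ (q^ β · W n k) m
        ≡⟨ cong (_+₂ eulerPartner n (suc k) m) (eulerPartner-≗ k≤n m) ⟨
      eulerPartner n k m +₂ eulerPartner n (suc k) m ∎
      where
      open ≡-Reasoning
      α = d * (suc n * k + triangular k)
      β = d * (triangular k + suc n * suc k)
      γ = d * (n * k + triangular k)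

    ∑eulerTerm : ∀ n → ∑ₛ (suc n) (eulerTerm n) ≗ eulerSum d n
    ∑eulerTerm zero    m = trans (∑ₛ-first 0 (eulerTerm 0) (λ ()))
                                 (cong (λ e → (q^ e · 1₂) m) (*-zeroʳ d))
    ∑eulerTerm (suc n) m = begin
      ∑ₛ (suc (suc n)) (eulerTerm (suc n)) m
        ≡⟨ ∑<-suc (suc n) (λ k → eulerTerm (suc n) k m) ⟩
      ∑ₛ (suc n) (eulerTerm (suc n)) m +₂ eulerTerm (suc n) (suc n) m
        ≡⟨ cong (_+₂ eulerTerm (suc n) (suc n) m) (telescoped m) ⟩
      ∑ₛ (suc n) (eulerTerm n) m +₂ eulerPartner n (suc n) m +₂ eulerTerm (suc n) (suc n) m
        ≡⟨ cong₂ (λ a b → a +₂ b +₂ eulerTerm (suc n) (suc n) m) (∑eulerTerm n m) (top⁻ m) ⟩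
      eulerSum d n m +₂ (q^ d * pentagonal⁻ n · 1₂) m +₂ eulerTerm (suc n) (suc n) m
        ≡⟨ cong (eulerSum d n m +₂ (q^ d * pentagonal⁻ n · 1₂) m +₂_) (top⁺ m) ⟩
      eulerSum d (suc n) m ∎
      where
      open ≡-Reasoning
      telescoped : ∑ₛ (suc n) (eulerTerm (suc n)) ≗ ∑ₛ (suc n) (eulerTerm n) ⊕ eulerPartner n (suc n)
      telescoped = ∑ₛ-telescope (suc n) (eulerTerm (suc n)) (eulerTerm n) (eulerPartner n) (λ _ → refl)
                                 (λ k<1+n → eulerTerm-step (≤-pred k<1+n))
      top⁻ : eulerPartner n (suc n) ≗ q^ d * pentagonal⁻ n · 1₂
      top⁻ = q^-cong (d * pentagonal⁻ n) (∏from-empty (multiples d) n 1₂)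
      top⁺ : eulerTerm (suc n) (suc n) ≗ q^ d * pentagonal⁺ n · 1₂
      top⁺ = q^-cong (d * pentagonal⁺ n) (∏from-empty (multiples d) (suc n) 1₂)

    eulerTerm-zero : ∀ n → eulerTerm n 0 ≗ ∏[1+q^ multiples d ]< n · 1₂
    eulerTerm-zero n m = cong (λ e → (q^ e · W n 0) m) (exponent d n)
      where
      exponent : ∀ d n → d * (n * 0 + 0) ≡ 0
      exponent = solve-∀

    eulerTerm-high : ∀ n k .{{_ : NonZero d}} {m} → m ≤ n → eulerTerm n (suc k) m ≡ 0ℙ
    eulerTerm-high n k m≤n = q^-below _ (W n (suc k)) (≤-<-trans m≤n n<exponent)
      where
      n<exponent : n < d * (n * suc k + triangular (suc k))
      n<exponent = <-≤-trans (≤-<-trans (m≤m*n n (suc k)) (m<m+n (n * suc k) (s≤s z≤n))) (m≤n*m _ d)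

    euler : ∀ n .{{_ : NonZero d}} → ∏[1+q^ multiples d ]< n · 1₂ ≗[≤ n ] eulerSum d n
    euler n {m} m≤n = begin
      (∏[1+q^ multiples d ]< n · 1₂) m  ≡⟨ eulerTerm-zero n m ⟨
      eulerTerm n 0 m                   ≡⟨ ∑ₛ-first n (eulerTerm n) (λ {k} _ → eulerTerm-high n k m≤n) ⟨
      ∑ₛ (suc n) (eulerTerm n) m        ≡⟨ ∑eulerTerm n m ⟩
      eulerSum d n m                    ∎
      where open ≡-Reasoning

  triangularSum : ℕ → ℕ → Series₂
  triangularSum d N = ∑ₛ N (λ j → q^ d * triangular j · 1₂)

  triangularSum-suc : ∀ d N → triangularSum d (suc N) ≗ triangularSum d N ⊕ q^ d * triangular N · 1₂
  triangularSum-suc d N m = ∑<-suc N (λ j → (q^ d * triangular j · 1₂) m)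

  triangularSum-+2 : ∀ d n → triangularSum d (suc (2 * suc n))
                   ≗ triangularSum d (suc (2 * n)) ⊕ q^ d * triangular (suc (2 * n)) · 1₂
                                                   ⊕ q^ d * triangular (suc (suc (2 * n))) · 1₂
  triangularSum-+2 d n m = begin
    triangularSum d (suc (2 * suc n)) m                ≡⟨ cong (λ N → triangularSum d (suc N) m) (*-suc 2 n) ⟩
    triangularSum d (suc (suc (suc (2 * n)))) m        ≡⟨ triangularSum-suc d _ m ⟩
    triangularSum d (suc (suc (2 * n))) m +₂ c         ≡⟨ cong (_+₂ c) (triangularSum-suc d _ m) ⟩
    triangularSum d (suc (2 * n)) m +₂ b +₂ c          ∎
    where
    open ≡-Reasoning
    b = (q^ d * triangular (suc (2 * n)) · 1₂) m
    c = (q^ d * triangular (suc (suc (2 * n))) · 1₂) m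

  module _ (d : ℕ) where

    private
      ψ ω : ℕ → ℕ
      ψ = multiples (2 * d)
      ω = oddMultiples d

      V : ℕ → ℕ → Series₂
      V n k = ∏[1+q^ ψ ]< n from k · ∏[1+q^ ω ]< k · 1₂

    -- The same for Gauss' identity, cleared of denominators.
    gaussTerm : ℕ → ℕ → Series₂
    gaussTerm n k = q^ d * (k * suc (2 * n)) · V n k

    gaussPartner : ℕ → ℕ → Series₂
    gaussPartner n zero    = 0₂
    gaussPartner n (suc k) = q^ d * (suc k * suc (2 * n)) · ∏[1+q^ ψ ]< n from k · ∏[1+q^ ω ]< suc k · 1₂

    gaussTerm-suc : ∀ {n k} → k ≤ n → gaussTerm (suc n) k
                  ≗ q^ d * (k * suc (2 * suc n)) · V n k ⊕ q^ d * (k * suc (2 * suc n)) + ψ n · V n k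
    gaussTerm-suc {n} {k} k≤n m = begin
      (q^ a · ∏[1+q^ ψ ]< suc n from k · Y) m          ≡⟨ q^-cong a (∏from-last ψ Y k≤n) m ⟩
      (q^ a · [1+q^ ψ n ]· V n k) m                    ≡⟨ q^·[1+q^] a (ψ n) (V n k) m ⟩
      (q^ a · V n k) m +₂ (q^ a + ψ n · V n k) m       ∎
      where
      open ≡-Reasoning
      a = d * (k * suc (2 * suc n))
      Y = ∏[1+q^ ω ]< k · 1₂

    [1+q^]·gaussTerm : ∀ n k → [1+q^ ω n ]· gaussTerm n k
                     ≗ q^ d * (k * suc (2 * n)) · V n k ⊕ q^ d * (k * suc (2 * n)) + ω n · V n k
    [1+q^]·gaussTerm n k m = trans ([1+q^]-q^ (ω n) e (V n k) m) (q^·[1+q^] e (ω n) (V n k) m)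
      where e = d * (k * suc (2 * n))

    gaussPartner-suc : ∀ {n k} → k ≤ n → gaussPartner n (suc k)
                     ≗ q^ d * (k * suc (2 * n)) + ω n · V n k ⊕ q^ d * (k * suc (2 * suc n)) + ψ n · V n k
    gaussPartner-suc {n} {k} k≤n m = begin
      (q^ e′ · ∏[1+q^ ψ ]< n from k · [1+q^ ω k ]· Y) m
        ≡⟨ q^-cong e′ ([1+q^]-∏ (ω k) (λ i → ψ (k + i)) (n ∸ k) Y) m ⟨
      (q^ e′ · [1+q^ ω k ]· V n k) m
        ≡⟨ q^·[1+q^] e′ (ω k) (V n k) m ⟩
      (q^ e′ · V n k) m +₂ (q^ e′ + ω k · V n k) m
        ≡⟨ cong₂ (λ x y → (q^ x · V n k) m +₂ (q^ y · V n k) m) (lower d n k) (upper d n k) ⟩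
      (q^ e + ω n · V n k) m +₂ (q^ a + ψ n · V n k) m ∎
      where
      open ≡-Reasoning
      e  = d * (k * suc (2 * n))
      e′ = d * (suc k * suc (2 * n))
      a  = d * (k * suc (2 * suc n))
      Y  = ∏[1+q^ ω ]< k · 1₂
      lower : ∀ d n k → d * (suc k * suc (2 * n)) ≡ d * (k * suc (2 * n)) + d * suc (2 * n)
      lower = solve-∀
      upper : ∀ d n k → d * (suc k * suc (2 * n)) + d * suc (2 * k)
                      ≡ d * (k * suc (2 * suc n)) + 2 * d * suc n
      upper = solve-∀

    gaussPartner-≗ : ∀ {n k} → k ≤ n → gaussPartner n k
                   ≗ q^ d * (k * suc (2 * n)) · V n k ⊕ q^ d * (k * suc (2 * suc n)) · V n k
    gaussPartner-≗ {n} {zero}  _   m = sym (ℙ.p+p≡0ℙ ((q^ d * 0 · V n 0) m))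
    gaussPartner-≗ {n} {suc k} k<n m = begin
      (q^ e · ∏[1+q^ ψ ]< n from k · Y) m
        ≡⟨ q^-cong e (∏from-first ψ Y k<n) m ⟩
      (q^ e · [1+q^ ψ k ]· V n (suc k)) m
        ≡⟨ q^·[1+q^] e (ψ k) (V n (suc k)) m ⟩
      (q^ e · V n (suc k)) m +₂ (q^ e + ψ k · V n (suc k)) m
        ≡⟨ cong (λ x → (q^ e · V n (suc k)) m +₂ (q^ x · V n (suc k)) m) (shift d n k) ⟩
      (q^ e · V n (suc k)) m +₂ (q^ a · V n (suc k)) m ∎
      where
      open ≡-Reasoning
      e = d * (suc k * suc (2 * n))
      a = d * (suc k * suc (2 * suc n))
      Y = ∏[1+q^ ω ]< suc k · 1₂
      shift : ∀ d n k → d * (suc k * suc (2 * n)) + 2 * d * suc k ≡ d * (suc k * suc (2 * suc n))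
      shift = solve-∀

    gaussTerm-step : ∀ {n k} → k ≤ n →
      gaussTerm (suc n) k ⊕ [1+q^ ω n ]· gaussTerm n k ≗ gaussPartner n k ⊕ gaussPartner n (suc k)
    gaussTerm-step {n} {k} k≤n m = begin
      gaussTerm (suc n) k m +₂ ([1+q^ ω n ]· gaussTerm n k) m
        ≡⟨ cong₂ _+₂_ (gaussTerm-suc k≤n m) ([1+q^]·gaussTerm n k m) ⟩
      (x₁ +₂ x₂) +₂ (y₁ +₂ y₂)
        ≡⟨ interchange x₁ x₂ y₁ y₂ ⟩
      (x₁ +₂ y₁) +₂ (x₂ +₂ y₂)
        ≡⟨ cong₂ _+₂_ (ℙ.+-comm x₁ y₁) (ℙ.+-comm x₂ y₂) ⟩
      (y₁ +₂ x₁) +₂ (y₂ +₂ x₂)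
        ≡⟨ cong₂ _+₂_ (gaussPartner-≗ k≤n m) (gaussPartner-suc k≤n m) ⟨
      gaussPartner n k m +₂ gaussPartner n (suc k) m ∎
      where
      open ≡-Reasoning
      e = d * (k * suc (2 * n))
      a = d * (k * suc (2 * suc n))
      x₁ = (q^ a · V n k) m
      x₂ = (q^ a + ψ n · V n k) m
      y₁ = (q^ e · V n k) m
      y₂ = (q^ e + ω n · V n k) m

    gaussPartner-top : ∀ n → gaussPartner n (suc n)
                     ≗ ∏[1+q^ ω ]< suc n · q^ d * triangular (suc (2 * n)) · 1₂
    gaussPartner-top n m = begin
      (q^ e · ∏[1+q^ ψ ]< n from n · Y) m
        ≡⟨ q^-cong e (∏from-empty ψ n Y) m ⟩
      (q^ e · Y) m
        ≡⟨ ∏-q^ ω (suc n) e 1₂ m ⟨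
      (∏[1+q^ ω ]< suc n · q^ e · 1₂) m
        ≡⟨ cong (λ t → (∏[1+q^ ω ]< suc n · q^ d * t · 1₂) m) (triangular-odd n) ⟨
      (∏[1+q^ ω ]< suc n · q^ d * triangular (suc (2 * n)) · 1₂) m ∎
      where
      open ≡-Reasoning
      e = d * (suc n * suc (2 * n))
      Y = ∏[1+q^ ω ]< suc n · 1₂

    gaussTerm-top : ∀ n → gaussTerm (suc n) (suc n)
                  ≗ ∏[1+q^ ω ]< suc n · q^ d * triangular (suc (suc (2 * n))) · 1₂
    gaussTerm-top n m = begin
      (q^ e · ∏[1+q^ ψ ]< suc n from suc n · Y) m
        ≡⟨ q^-cong e (∏from-empty ψ (suc n) Y) m ⟩
      (q^ e · Y) m
        ≡⟨ ∏-q^ ω (suc n) e 1₂ m ⟨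
      (∏[1+q^ ω ]< suc n · q^ e · 1₂) m
        ≡⟨ cong (λ t → (∏[1+q^ ω ]< suc n · q^ d * t · 1₂) m) (triangular-even n) ⟨
      (∏[1+q^ ω ]< suc n · q^ d * triangular (suc (suc (2 * n))) · 1₂) m ∎
      where
      open ≡-Reasoning
      e = d * (suc n * suc (2 * suc n))
      Y = ∏[1+q^ ω ]< suc n · 1₂

    ∑gaussTerm : ∀ n → ∑ₛ (suc n) (gaussTerm n) ≗ ∏[1+q^ ω ]< n · triangularSum d (suc (2 * n))
    ∑gaussTerm zero    m = ∑<-cong 1 (λ { (s≤s z≤n) → refl })
    ∑gaussTerm (suc n) m = begin
      ∑ₛ (suc (suc n)) (gaussTerm (suc n)) m
        ≡⟨ ∑<-suc (suc n) (λ k → gaussTerm (suc n) k m) ⟩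
      ∑ₛ (suc n) (gaussTerm (suc n)) m +₂ gaussTerm (suc n) (suc n) m
        ≡⟨ cong (_+₂ gaussTerm (suc n) (suc n) m) (telescoped m) ⟩
      ∑ₛ (suc n) ω-times-gaussTerm m +₂ gaussPartner n (suc n) m +₂ gaussTerm (suc n) (suc n) m
        ≡⟨ cong₂ (λ x y → x +₂ y +₂ gaussTerm (suc n) (suc n) m) (previous m) (gaussPartner-top n m) ⟩
      P Θ +₂ P (q^ a · 1₂) +₂ gaussTerm (suc n) (suc n) m
        ≡⟨ cong (P Θ +₂ P (q^ a · 1₂) +₂_) (gaussTerm-top n m) ⟩
      P Θ +₂ P (q^ a · 1₂) +₂ P (q^ b · 1₂)
        ≡⟨ cong (_+₂ P (q^ b · 1₂)) (∏-distrib-⊕ ω (suc n) Θ (q^ a · 1₂) m) ⟨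
      P (Θ ⊕ q^ a · 1₂) +₂ P (q^ b · 1₂)
        ≡⟨ ∏-distrib-⊕ ω (suc n) (Θ ⊕ q^ a · 1₂) (q^ b · 1₂) m ⟨
      P (Θ ⊕ q^ a · 1₂ ⊕ q^ b · 1₂)
        ≡⟨ ∏-cong ω (suc n) (triangularSum-+2 d n) m ⟨
      P (triangularSum d (suc (2 * suc n))) ∎
      where
      open ≡-Reasoning
      Θ = triangularSum d (suc (2 * n))
      a = d * triangular (suc (2 * n))
      b = d * triangular (suc (suc (2 * n)))
      P : Series₂ → Parity
      P f = (∏[1+q^ ω ]< suc n · f) m
      ω-times-gaussTerm : ℕ → Series₂
      ω-times-gaussTerm k = [1+q^ ω n ]· gaussTerm n k
      telescoped : ∑ₛ (suc n) (gaussTerm (suc n)) ≗ ∑ₛ (suc n) ω-times-gaussTerm ⊕ gaussPartner n (suc n)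
      telescoped = ∑ₛ-telescope (suc n) (gaussTerm (suc n)) ω-times-gaussTerm (gaussPartner n) (λ _ → refl)
                                 (λ k<1+n → gaussTerm-step (≤-pred k<1+n))
      previous : ∑ₛ (suc n) ω-times-gaussTerm ≗ ∏[1+q^ ω ]< suc n · Θ
      previous m = trans (sym ([1+q^]-∑ₛ (ω n) (suc n) (gaussTerm n) m))
                         ([1+q^]-cong (ω n) (∑gaussTerm n) m)

    gaussTerm-zero : ∀ n → gaussTerm n 0 ≗ ∏[1+q^ ψ ]< n · 1₂
    gaussTerm-zero n m = cong (λ e → (q^ e · V n 0) m) (*-zeroʳ d)

    gaussTerm-high : ∀ n k .{{_ : NonZero d}} {m} → m ≤ n → gaussTerm n (suc k) m ≡ 0ℙ
    gaussTerm-high n k m≤n = q^-below _ (V n (suc k)) (≤-<-trans m≤n n<exponent)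
      where
      n<exponent : n < d * (suc k * suc (2 * n))
      n<exponent = <-≤-trans (s≤s (m≤n*m n 2)) (≤-trans (m≤n*m (suc (2 * n)) (suc k)) (m≤n*m _ d))

    gauss : ∀ n .{{_ : NonZero d}} → ∏[1+q^ multiples (2 * d) ]< n · 1₂
                                   ≗[≤ n ] ∏[1+q^ oddMultiples d ]< n · triangularSum d (suc (2 * n))
    gauss n {m} m≤n = begin
      (∏[1+q^ ψ ]< n · 1₂) m            ≡⟨ gaussTerm-zero n m ⟨
      gaussTerm n 0 m                   ≡⟨ ∑ₛ-first n (gaussTerm n) (λ {k} _ → gaussTerm-high n k m≤n) ⟨
      ∑ₛ (suc n) (gaussTerm n) m        ≡⟨ ∑gaussTerm n m ⟩
      (∏[1+q^ ω ]< n · triangularSum d (suc (2 * n))) m ∎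
      where open ≡-Reasoning

  -- Multiplied by ∏ (1 + q^{d(2i+1)}), the left side becomes ∏ (1 + q^{2d(i+1)}) up to degree n,
  -- by Frobenius; Gauss' identity does the same for the right side.
  jacobi : ∀ d n .{{_ : NonZero d}} → ∏[1+q^ multiples d ]< n · ∏[1+q^ multiples (2 * d) ]< n · 1₂
                                    ≗[≤ n ] triangularSum d (suc (2 * n))
  jacobi d n = ∏-cancel ω n n ω-positive multiplied
    where
    φ ψ ω : ℕ → ℕ
    φ = multiples d
    ψ = multiples (2 * d)
    ω = oddMultiples d
    ω-positive : ∀ i → 0 < ω i
    ω-positive i = >-nonZero⁻¹ (ω i) {{m*n≢0 d (suc (2 * i))}}
    X = ∏[1+q^ ψ ]< n · 1₂
    multiplied : ∏[1+q^ ω ]< n · ∏[1+q^ φ ]< n · X ≗[≤ n ] ∏[1+q^ ω ]< n · triangularSum d (suc (2 * n))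
    multiplied {m} m≤n = begin
      (∏[1+q^ ω ]< n · ∏[1+q^ φ ]< n · X) m
        ≡⟨ ∏-≗[≤] ω n (∏multiples-drop d n X) m≤n ⟨
      (∏[1+q^ ω ]< n · ∏[1+q^ φ ]< 2 * n · X) m
        ≡⟨ ∏-cong ω n (∏-split d n X) m ⟩
      (∏[1+q^ ω ]< n · ∏[1+q^ ω ]< n · ∏[1+q^ ψ ]< n · X) m
        ≡⟨ ∏-cong ω n (∏-cong ω n (∏-frobenius ψ n 1₂)) m ⟩
      (∏[1+q^ ω ]< n · ∏[1+q^ ω ]< n · ∏[1+q^ 2*ψ ]< n · 1₂) m
        ≡⟨ ∏-frobenius ω n _ m ⟩
      (∏[1+q^ 2*ω ]< n · ∏[1+q^ 2*ψ ]< n · 1₂) m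
        ≡⟨ trans (∏-cong-exponents n _ (λ i → sym (*-assoc 2 d _)) m)
                 (∏-cong (oddMultiples (2 * d)) n (∏-cong-exponents n 1₂ (λ i → sym (*-assoc 2 (2 * d) _))) m) ⟩
      (∏[1+q^ oddMultiples (2 * d) ]< n · ∏[1+q^ multiples (2 * (2 * d)) ]< n · 1₂) m
        ≡⟨ ∏-split (2 * d) n 1₂ m ⟨
      (∏[1+q^ ψ ]< 2 * n · 1₂) m
        ≡⟨ ∏multiples-drop (2 * d) n 1₂ {{m*n≢0 2 d}} m≤n ⟩
      (∏[1+q^ ψ ]< n · 1₂) m
        ≡⟨ gauss d n m≤n ⟩
      (∏[1+q^ ω ]< n · triangularSum d (suc (2 * n))) m ∎
      where
      open ≡-Reasoning
      2*ψ 2*ω : ℕ → ℕ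
      2*ψ i = 2 * ψ i
      2*ω i = 2 * ω i

  -- By 8*triangular-3n+1, these are the exponents of Δ(q^9)/q.
  ninthSum : ℕ → Series₂
  ninthSum N = ∑ₛ N (λ j → q^ 8 * triangular (suc (3 * j)) · 1₂)

  triangularSum-mod3 : ∀ N → triangularSum 8 (suc (3 * N)) ≗ eulerSum 24 N ⊕ ninthSum N
  triangularSum-mod3 zero    m = begin
    triangularSum 8 1 m     ≡⟨ ∑ₛ-first 0 (λ j → q^ 8 * triangular j · 1₂) (λ ()) ⟩
    1₂ m                    ≡⟨ ℙ.+-identityʳ (1₂ m) ⟨
    1₂ m +₂ 0ℙ              ≡⟨ cong (1₂ m +₂_) (∑<-zero 0 (λ ())) ⟨
    1₂ m +₂ ninthSum 0 m    ∎
    where open ≡-Reasoning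
  triangularSum-mod3 (suc N) m = begin
    triangularSum 8 (suc (3 * suc N)) m
      ≡⟨ cong (λ K → triangularSum 8 (suc K) m) (*-suc 3 N) ⟩
    triangularSum 8 (suc (suc (suc (suc (3 * N))))) m
      ≡⟨ triangularSum-suc 8 _ m ⟩
    triangularSum 8 (suc (suc (suc (3 * N)))) m +₂ c
      ≡⟨ cong (_+₂ c) (triangularSum-suc 8 _ m) ⟩
    triangularSum 8 (suc (suc (3 * N))) m +₂ b +₂ c
      ≡⟨ cong (λ x → x +₂ b +₂ c) (triangularSum-suc 8 _ m) ⟩
    triangularSum 8 (suc (3 * N)) m +₂ a +₂ b +₂ c
      ≡⟨ cong (λ x → x +₂ a +₂ b +₂ c) (triangularSum-mod3 N m) ⟩
    eulerSum 24 N m +₂ ninthSum N m +₂ a +₂ b +₂ c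
      ≡⟨ shuffle (eulerSum 24 N m) (ninthSum N m) a b c ⟩
    eulerSum 24 N m +₂ b +₂ c +₂ (ninthSum N m +₂ a)
      ≡⟨ cong₂ (λ x y → eulerSum 24 N m +₂ x +₂ y +₂ (ninthSum N m +₂ a))
               (exponent (suc (suc (3 * N))) (pentagonal⁻ N) (triangular-3n+2 N))
               (exponent (suc (suc (suc (3 * N)))) (pentagonal⁺ N) (triangular-3n+3 N)) ⟩
    eulerSum 24 (suc N) m +₂ (ninthSum N m +₂ a)
      ≡⟨ cong (eulerSum 24 (suc N) m +₂_) (∑<-suc N (λ j → (q^ 8 * triangular (suc (3 * j)) · 1₂) m)) ⟨
    eulerSum 24 (suc N) m +₂ ninthSum (suc N) m ∎
    where
    open ≡-Reasoning
    a = (q^ 8 * triangular (suc (3 * N)) · 1₂) m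
    b = (q^ 8 * triangular (suc (suc (3 * N))) · 1₂) m
    c = (q^ 8 * triangular (suc (suc (suc (3 * N)))) · 1₂) m
    exponent : ∀ k p → triangular k ≡ 3 * p → (q^ 8 * triangular k · 1₂) m ≡ (q^ 24 * p · 1₂) m
    exponent k p Tk≡3p = cong (λ e → (q^ e · 1₂) m) (trans (cong (8 *_) Tk≡3p) (sym (*-assoc 8 3 p)))
    shuffle : ∀ e n a b c → e +₂ n +₂ a +₂ b +₂ c ≡ e +₂ b +₂ c +₂ (n +₂ a)
    shuffle e n a b c = begin
      e +₂ n +₂ a +₂ b +₂ c       ≡⟨ cong (λ x → x +₂ b +₂ c) (ℙ.+-assoc e n a) ⟩
      e +₂ (n +₂ a) +₂ b +₂ c     ≡⟨ cong (_+₂ c) (xy∙z≈xz∙y e (n +₂ a) b) ⟩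
      e +₂ b +₂ (n +₂ a) +₂ c     ≡⟨ xy∙z≈xz∙y (e +₂ b) (n +₂ a) c ⟩
      e +₂ b +₂ c +₂ (n +₂ a)     ∎

  triangularSum-stable : ∀ d N k {m} .{{_ : NonZero d}} → m < N →
                         triangularSum d (k + N) m ≡ triangularSum d N m
  triangularSum-stable d N zero        m<N = refl
  triangularSum-stable d N (suc k) {m} m<N = begin
    triangularSum d (suc (k + N)) m
      ≡⟨ triangularSum-suc d (k + N) m ⟩
    triangularSum d (k + N) m +₂ (q^ d * triangular (k + N) · 1₂) m
      ≡⟨ cong (triangularSum d (k + N) m +₂_) (q^-below _ 1₂ m<exponent) ⟩
    triangularSum d (k + N) m +₂ 0ℙ
      ≡⟨ ℙ.+-identityʳ _ ⟩
    triangularSum d (k + N) m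
      ≡⟨ triangularSum-stable d N k m<N ⟩
    triangularSum d N m ∎
    where
    open ≡-Reasoning
    n≤triangular : ∀ n → n ≤ triangular n
    n≤triangular zero    = z≤n
    n≤triangular (suc n) = m≤m+n (suc n) (triangular n)
    m<exponent : m < d * triangular (k + N)
    m<exponent = <-≤-trans m<N (≤-trans (m≤n+m N k) (≤-trans (n≤triangular (k + N)) (m≤n*m _ d)))

  ninthSum-off : ∀ N m → (∀ x → m ≢ 8 + 9 * x) → ninthSum N m ≡ 0ℙ
  ninthSum-off N m m≢8+9x = ∑<-zero N (λ {j} _ →
    q^·1₂-off _ (λ m≡ → m≢8+9x (8 * triangular j) (trans m≡ (8*triangular-3n+1 j))))

  ninthSum-dilate : ∀ N u → ninthSum N (8 + 9 * u) ≡ triangularSum 8 N u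
  ninthSum-dilate N u = ∑<-cong N (λ {j} _ →
    trans (cong (λ e → (q^ e · 1₂) (8 + 9 * u)) (8*triangular-3n+1 j))
          (q^·1₂-dilate 8 9 (8 * triangular j) u))

  parityℤ-C : ∀ m → parityℤ (C (suc m)) ≡ eulerSum 24 m m
  parityℤ-C m = trans (parityℤ-prodUpTo-3-8 m m) (euler 24 m ≤-refl)

  parityℤ-Δ : ∀ m → parityℤ (Δ (suc m)) ≡ triangularSum 8 (suc (3 * m)) m
  parityℤ-Δ m = begin
    parityℤ (Δ (suc m))
      ≡⟨ parityℤ-prodUpTo-1-24 m m ⟩
    (∏[1+q^ multiples 8 ]< m · ∏[1+q^ multiples 16 ]< m · 1₂) m
      ≡⟨ jacobi 8 m ≤-refl ⟩
    triangularSum 8 (suc (2 * m)) m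
      ≡⟨ triangularSum-stable 8 (suc (2 * m)) m (s≤s (m≤n*m m 2)) ⟨
    triangularSum 8 (m + suc (2 * m)) m
      ≡⟨ cong (λ N → triangularSum 8 N m) (+-suc m (2 * m)) ⟩
    triangularSum 8 (suc (m + 2 * m)) m ∎
    where open ≡-Reasoning

  ninthSum-diagonal : ∀ u → ninthSum (8 + 9 * u) (8 + 9 * u) ≡ parityℤ (Δ (suc u))
  ninthSum-diagonal u = begin
    ninthSum (8 + 9 * u) (8 + 9 * u)
      ≡⟨ ninthSum-dilate (8 + 9 * u) u ⟩
    triangularSum 8 (8 + 9 * u) u
      ≡⟨ cong (λ N → triangularSum 8 N u) (split u) ⟩
    triangularSum 8 (6 * u + 7 + suc (3 * u)) u
      ≡⟨ triangularSum-stable 8 (suc (3 * u)) (6 * u + 7) (s≤s (m≤n*m u 3)) ⟩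
    triangularSum 8 (suc (3 * u)) u
      ≡⟨ parityℤ-Δ u ⟨
    parityℤ (Δ (suc u)) ∎
    where
    open ≡-Reasoning
    split : ∀ u → 8 + 9 * u ≡ 6 * u + 7 + suc (3 * u)
    split = solve-∀

  1+[8+9x]%9≡0 : ∀ x → suc (8 + 9 * x) % 9 ≡ 0
  1+[8+9x]%9≡0 x = trans (cong (_% 9) (nine x)) (m*n%n≡0 (suc x) 9)
    where
    nine : ∀ x → suc (8 + 9 * x) ≡ suc x * 9
    nine = solve-∀

  parityℤ-Δ[q^9] : ∀ m → parityℤ (Δ[q^9] (suc m)) ≡ ninthSum m m
  parityℤ-Δ[q^9] m with suc m % 9 ≡ᵇ 0 in 9∣1+m?
  ... | true  = Δ-at-quotient (suc m / 9) (trans (m≡m%n+[m/n]*n (suc m) 9)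
                  (cong (_+ suc m / 9 * 9) (≡ᵇ⇒≡ (suc m % 9) 0 (subst T (sym 9∣1+m?) tt))))
    where
    Δ-at-quotient : ∀ q → suc m ≡ q * 9 → parityℤ (Δ q) ≡ ninthSum m m
    Δ-at-quotient (suc u) 1+m≡ =
      subst (λ k → parityℤ (Δ (suc u)) ≡ ninthSum k k) (sym (suc-injective (trans 1+m≡ (nine u))))
            (sym (ninthSum-diagonal u))
      where
      nine : ∀ u → suc u * 9 ≡ suc (8 + 9 * u)
      nine = solve-∀
  ... | false = sym (ninthSum-off m m m≢8+9x)
    where
    m≢8+9x : ∀ x → m ≢ 8 + 9 * x
    m≢8+9x x m≡8+9x = contradiction (trans (sym (cong (_≡ᵇ 0) 1+m%9≡0)) 9∣1+m?) (λ ())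
      where
      1+m%9≡0 : suc m % 9 ≡ 0
      1+m%9≡0 = trans (cong (λ k → suc k % 9) m≡8+9x) (1+[8+9x]%9≡0 x)

  parityℤ-C≡Δ+Δ[q^9] : ∀ m → parityℤ (C m) ≡ parityℤ (Δ m) +₂ parityℤ (Δ[q^9] m)
  parityℤ-C≡Δ+Δ[q^9] zero    = refl
  parityℤ-C≡Δ+Δ[q^9] (suc m) = begin
    parityℤ (C (suc m))
      ≡⟨ parityℤ-C m ⟩
    eulerSum 24 m m
      ≡⟨ +₂-move (eulerSum 24 m m) (ninthSum m m) _ (sym (triangularSum-mod3 m m)) ⟩
    ninthSum m m +₂ triangularSum 8 (suc (3 * m)) m
      ≡⟨ ℙ.+-comm (ninthSum m m) _ ⟩
    triangularSum 8 (suc (3 * m)) m +₂ ninthSum m m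
      ≡⟨ cong₂ _+₂_ (parityℤ-Δ m) (parityℤ-Δ[q^9] m) ⟨
    parityℤ (Δ (suc m)) +₂ parityℤ (Δ[q^9] (suc m)) ∎
    where open ≡-Reasoning

open import Data.Nat using (ℕ)
open import Data.Integer using (+_; -_; _+_; _-_)
open import Data.Integer.Divisibility using (_∣_)
open import Data.Parity.Base using (0ℙ) renaming (_+_ to _+₂_)
open import Data.Parity.Properties using (p+p≡0ℙ)
open import Relation.Binary.PropositionalEquality
open Mod2 using (parityℤ; parityℤ-homo-+; parityℤ-homo--; parity≡0ℙ⇒2∣; parityℤ-C≡Δ+Δ[q^9])

lemma2p3 : ∀ (m : ℕ) → (+ 2) ∣ (C m - (Δ m + Δ[q^9] m))
lemma2p3 m = parity≡0ℙ⇒2∣ _ (begin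
  parityℤ (C m - (Δ m + Δ[q^9] m))
    ≡⟨ parityℤ-homo-+ (C m) (- (Δ m + Δ[q^9] m)) ⟩
  parityℤ (C m) +₂ parityℤ (- (Δ m + Δ[q^9] m))
    ≡⟨ cong (parityℤ (C m) +₂_) (parityℤ-homo-- (Δ m + Δ[q^9] m)) ⟩
  parityℤ (C m) +₂ parityℤ (Δ m + Δ[q^9] m)
    ≡⟨ cong₂ _+₂_ (parityℤ-C≡Δ+Δ[q^9] m) (parityℤ-homo-+ (Δ m) (Δ[q^9] m)) ⟩
  δ +₂ δ
    ≡⟨ p+p≡0ℙ δ ⟩
  0ℙ ∎)
  where
  open ≡-Reasoning
  δ = parityℤ (Δ m) +₂ parityℤ (Δ[q^9] m)
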